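{- Let $V$ be a set of $n$ vertices, and for each $v\in V$ let $S_v\subseteq V\setminus\{v\}$ with $|S_v|\ge 1$. Let $l:V\to\{0,1\}$ be random with $\{l(v)\}_{v\in V}$ i.i.d. Bernoulli random variables with $\Pr(l(v)=1)=\frac12$. Let $L=\{v\in V: l(v)=1\}\cup\{v\in V: l(u)=0 \text{ for all } u\in S_v\cup\{v\}\}$. Then $\mathbb{E}(|L|)\le 0.75n$. -}

module Defs where

open import Data.Nat using (ℕ; zero; suc)
open import Data.Bool using (Bool; true; false; _∨_; _∧_; not)
open import Data.Fin using (Fin; zero; suc)
open import Data.Vec using (Vec; []; _∷_; lookup; tabulate)
open import Data.List using (List; [_]; _++_; map)
open import Data.Nat.ListAction using (sum)
open import Data.Fin.Subset using (Subset; _∪_; ⁅_⁆; ∣_∣)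

anyFin : ∀ {n} → (Fin n → Bool) → Bool
anyFin {zero}  f = false
anyFin {suc n} f = f zero ∨ anyFin (λ u → f (suc u))

-- All 2^n labelings l : V → {0,1} of V = Fin n (true = 1, false = 0),
-- each listed exactly once.
allLabelings : ∀ n → List (Vec Bool n)
allLabelings zero    = [ [] ]
allLabelings (suc n) = map (true ∷_) (allLabelings n) ++ map (false ∷_) (allLabelings n)

LSet : ∀ {n} → (Fin n → Subset n) → Vec Bool n → Subset n
LSet {n} S l = tabulate λ v →
  lookup l v ∨ not (anyFin λ u → lookup (S v ∪ ⁅ v ⁆) u ∧ lookup l u)

-- Σ over all labelings l of |L(l)|; E|L| = sumL / 2^n under the uniform
-- (i.i.d. Bernoulli(1/2)) distribution.
sumL : ∀ {n} → (Fin n → Subset n) → ℕ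
sumL {n} S = sum (map (λ l → ∣ LSet S l ∣) (allLabelings n))

-- Proof (linearity of expectation).  Counting |L| vertex by vertex and
-- exchanging the two finite sums, sumL S is the sum over vertices v of the
-- number of labelings l with v ∈ L(l).  Fix v and pick u ∈ S v (possible as
-- |S v| ≥ 1); u ≠ v because v ∉ S v.  If v ∈ L(l) then l(v) = 1 or l(u) = 0,
-- since l(u) = 1 with u ∈ S v ∪ {v} would exclude v from the second part of L.
-- For two distinct coordinates the pair (l(v), l(u)) is uniformly distributed
-- over Bool × Bool, so exactly 3/4 of all labelings satisfy l(v) = 1 ∨ l(u) = 0.
-- Summing the bound 3 · 2^n / 4 over the n vertices gives the theorem.

module Submission where

open import Defs
open import Data.Nat using (ℕ; _≤_; _*_; _^_; zero; suc; _+_; z≤n)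
open import Data.Nat.Properties
open import Data.Nat.ListAction using (sum)
open import Data.Nat.ListAction.Properties using (sum-++)
open import Data.Nat.Solver using (module +-*-Solver)
open import Algebra.Properties.CommutativeSemigroup +-commutativeSemigroup using (interchange)
open import Data.Bool using (Bool; true; false; _∨_; _∧_; not)
open import Data.Bool.Properties using (∨-zeroʳ)
open import Data.Fin using (Fin; zero; suc)
open import Data.Fin.Subset using (Subset; _∈_; _∉_; ∣_∣; _∪_; ⁅_⁆; Nonempty)
open import Data.Fin.Subset.Properties using (nonempty?; Empty-unique; ∣⊥∣≡0; x∈p∪q⁺)
open import Data.Vec using (Vec; []; _∷_; lookup; tabulate)
open import Data.Vec.Properties using ([]=⇒lookup)
open import Data.List using (List; map; _++_)
open import Data.List.Properties using (map-++; map-∘; map-cong)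
open import Data.Sum using (inj₁)
open import Data.Product using (_,_)
open import Function using (flip; _∘_)
open import Relation.Nullary using (yes; no; contradiction)
open import Relation.Binary.PropositionalEquality

indicator : Bool → ℕ
indicator true  = 1
indicator false = 0

indicator≤1 : ∀ b → indicator b ≤ 1
indicator≤1 true  = ≤-refl
indicator≤1 false = z≤n

module _ where
  open +-*-Solver

  double-both : ∀ k A c p → k * A ≡ c * p → k * (A + A) ≡ c * (2 * p)
  double-both k A c p kA≡cp = begin
    k * (A + A)  ≡⟨ solve 2 (λ k A → k :* (A :+ A) := con 2 :* (k :* A)) refl k A ⟩
    2 * (k * A)  ≡⟨ cong (2 *_) kA≡cp ⟩
    2 * (c * p)  ≡⟨ solve 2 (λ c p → con 2 :* (c :* p) := c :* (con 2 :* p)) refl c p ⟩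
    c * (2 * p)  ∎
    where open ≡-Reasoning

  combine-halves : ∀ k A B a b p → k * A ≡ a * p → k * B ≡ b * p →
                   (2 * k) * (A + B) ≡ (a + b) * (2 * p)
  combine-halves k A B a b p kA≡ap kB≡bp = begin
    (2 * k) * (A + B)        ≡⟨ solve 3 (λ k A B → (con 2 :* k) :* (A :+ B)
                                   := con 2 :* (k :* A) :+ con 2 :* (k :* B)) refl k A B ⟩
    2 * (k * A) + 2 * (k * B) ≡⟨ cong₂ (λ x y → 2 * x + 2 * y) kA≡ap kB≡bp ⟩
    2 * (a * p) + 2 * (b * p) ≡⟨ solve 3 (λ a b p → con 2 :* (a :* p) :+ con 2 :* (b :* p)
                                   := (a :+ b) :* (con 2 :* p)) refl a b p ⟩
    (a + b) * (2 * p)        ∎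
    where open ≡-Reasoning

-- Σₗ n f: the sum of f over all 2^n labelings of n vertices, i.e. 2^n times
-- the expectation of f under uniform labelings.  Σₗ is opaque: elsewhere it
-- is handled only through its relation to sumL and the three basic laws
-- proved in this block (empty labeling, splitting on the first label,
-- congruence).
opaque
  Σₗ : ∀ n → (Vec Bool n → ℕ) → ℕ
  Σₗ n f = sum (map f (allLabelings n))

  sumL≡Σₗ : ∀ {n} (S : Fin n → Subset n) → sumL S ≡ Σₗ n (λ l → ∣ LSet S l ∣)
  sumL≡Σₗ S = refl

  Σₗ-zero : (f : Vec Bool 0 → ℕ) → Σₗ 0 f ≡ f []
  Σₗ-zero f = +-identityʳ _

  Σₗ-cons : ∀ n (f : Vec Bool (suc n) → ℕ) →
            Σₗ (suc n) f ≡ Σₗ n (λ l → f (true ∷ l)) + Σₗ n (λ l → f (false ∷ l))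
  Σₗ-cons n f = begin
      sum (map f (map (true ∷_) L ++ map (false ∷_) L))
    ≡⟨ cong sum (map-++ f (map (true ∷_) L) (map (false ∷_) L)) ⟩
      sum (map f (map (true ∷_) L) ++ map f (map (false ∷_) L))
    ≡⟨ sum-++ (map f (map (true ∷_) L)) _ ⟩
      sum (map f (map (true ∷_) L)) + sum (map f (map (false ∷_) L))
    ≡⟨ cong₂ _+_ (cong sum (sym (map-∘ L))) (cong sum (sym (map-∘ L))) ⟩
      Σₗ n (λ l → f (true ∷ l)) + Σₗ n (λ l → f (false ∷ l))
    ∎
    where open ≡-Reasoning
          L : List (Vec Bool n)
          L = allLabelings n

  Σₗ-cong : ∀ n {f g : Vec Bool n → ℕ} → (∀ l → f l ≡ g l) → Σₗ n f ≡ Σₗ n g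
  Σₗ-cong n f≗g = cong sum (map-cong f≗g (allLabelings n))

Σₗ-const : ∀ n c → Σₗ n (λ _ → c) ≡ c * 2 ^ n
Σₗ-const zero    c = trans (Σₗ-zero _) (sym (*-identityʳ c))
Σₗ-const (suc n) c = begin
  Σₗ (suc n) (λ _ → c)  ≡⟨ Σₗ-cons n _ ⟩
  A + A                 ≡⟨ sym (*-identityˡ (A + A)) ⟩
  1 * (A + A)           ≡⟨ double-both 1 A c (2 ^ n) (trans (*-identityˡ A) (Σₗ-const n c)) ⟩
  c * 2 ^ suc n         ∎
  where open ≡-Reasoning
        A : ℕ
        A = Σₗ n (λ _ → c)

Σₗ-+ : ∀ n (f g : Vec Bool n → ℕ) → Σₗ n (λ l → f l + g l) ≡ Σₗ n f + Σₗ n g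
Σₗ-+ zero f g = trans (Σₗ-zero _) (sym (cong₂ _+_ (Σₗ-zero f) (Σₗ-zero g)))
Σₗ-+ (suc n) f g = begin
    Σₗ (suc n) (λ l → f l + g l)
  ≡⟨ Σₗ-cons n _ ⟩
    Σₗ n (λ l → f (true ∷ l) + g (true ∷ l)) + Σₗ n (λ l → f (false ∷ l) + g (false ∷ l))
  ≡⟨ cong₂ _+_ (Σₗ-+ n _ _) (Σₗ-+ n _ _) ⟩
    (Σₗ n (λ l → f (true ∷ l)) + Σₗ n (λ l → g (true ∷ l)))
      + (Σₗ n (λ l → f (false ∷ l)) + Σₗ n (λ l → g (false ∷ l)))
  ≡⟨ interchange (Σₗ n (λ l → f (true ∷ l))) (Σₗ n (λ l → g (true ∷ l)))
                 (Σₗ n (λ l → f (false ∷ l))) (Σₗ n (λ l → g (false ∷ l))) ⟩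
    (Σₗ n (λ l → f (true ∷ l)) + Σₗ n (λ l → f (false ∷ l)))
      + (Σₗ n (λ l → g (true ∷ l)) + Σₗ n (λ l → g (false ∷ l)))
  ≡⟨ sym (cong₂ _+_ (Σₗ-cons n f) (Σₗ-cons n g)) ⟩
    Σₗ (suc n) f + Σₗ (suc n) g
  ∎
  where open ≡-Reasoning

Σₗ-mono : ∀ n {f g : Vec Bool n → ℕ} → (∀ l → f l ≤ g l) → Σₗ n f ≤ Σₗ n g
Σₗ-mono zero {f} {g} f≤g = subst₂ _≤_ (sym (Σₗ-zero f)) (sym (Σₗ-zero g)) (f≤g [])
Σₗ-mono (suc n) {f} {g} f≤g = begin
  Σₗ (suc n) f  ≡⟨ Σₗ-cons n f ⟩
  Σₗ n (λ l → f (true ∷ l)) + Σₗ n (λ l → f (false ∷ l))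
                ≤⟨ +-mono-≤ (Σₗ-mono n (f≤g ∘ (true ∷_))) (Σₗ-mono n (f≤g ∘ (false ∷_))) ⟩
  Σₗ n (λ l → g (true ∷ l)) + Σₗ n (λ l → g (false ∷ l))
                ≡⟨ sym (Σₗ-cons n g) ⟩
  Σₗ (suc n) g  ∎
  where open ≤-Reasoning

Σₗ-one : ∀ n (g : Bool → ℕ) (u : Fin n) →
         2 * Σₗ n (λ l → g (lookup l u)) ≡ (g true + g false) * 2 ^ n
Σₗ-one (suc n) g zero = trans (cong (2 *_) (Σₗ-cons n _))
  (combine-halves 1 A B (g true) (g false) (2 ^ n)
    (trans (*-identityˡ A) (Σₗ-const n (g true))) (trans (*-identityˡ B) (Σₗ-const n (g false))))
  where A B : ℕ
        A = Σₗ n (λ _ → g true)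
        B = Σₗ n (λ _ → g false)
Σₗ-one (suc n) g (suc u) = trans (cong (2 *_) (Σₗ-cons n _))
  (double-both 2 (Σₗ n (λ l → g (lookup l u))) (g true + g false) (2 ^ n) (Σₗ-one n g u))

total : (Bool → Bool → ℕ) → ℕ
total h = (h true true + h true false) + (h false true + h false false)

total-flip : ∀ h → total (flip h) ≡ total h
total-flip h = interchange (h true true) (h false true) (h true false) (h false false)

Σₗ-two : ∀ n (h : Bool → Bool → ℕ) (v u : Fin n) → v ≢ u →
         4 * Σₗ n (λ l → h (lookup l v) (lookup l u)) ≡ total h * 2 ^ n
Σₗ-two (suc n) h zero    zero    v≢u = contradiction refl v≢u
Σₗ-two (suc n) h zero    (suc u) _   = trans (cong (4 *_) (Σₗ-cons n _))
  (combine-halves 2 (Σₗ n (λ l → h true (lookup l u))) (Σₗ n (λ l → h false (lookup l u)))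
    (h true true + h true false) (h false true + h false false) (2 ^ n)
    (Σₗ-one n (h true) u) (Σₗ-one n (h false) u))
Σₗ-two (suc n) h (suc v) zero    v≢u =
  trans (Σₗ-two (suc n) (flip h) zero (suc v) (v≢u ∘ sym)) (cong (_* 2 ^ suc n) (total-flip h))
Σₗ-two (suc n) h (suc v) (suc u) v≢u = trans (cong (4 *_) (Σₗ-cons n _))
  (double-both 4 (Σₗ n (λ l → h (lookup l v) (lookup l u))) (total h) (2 ^ n)
    (Σₗ-two n h v u (v≢u ∘ cong suc)))

Σᵥ : ∀ {m} → (Fin m → ℕ) → ℕ
Σᵥ {zero}  f = 0
Σᵥ {suc m} f = f zero + Σᵥ (f ∘ suc)

∣tabulate∣ : ∀ {m} (g : Fin m → Bool) → ∣ tabulate g ∣ ≡ Σᵥ (indicator ∘ g)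
∣tabulate∣ {zero}  g = refl
∣tabulate∣ {suc m} g with g zero
... | true  = cong suc (∣tabulate∣ (g ∘ suc))
... | false = ∣tabulate∣ (g ∘ suc)

Σₗ-Σᵥ-comm : ∀ n {m} (F : Vec Bool n → Fin m → ℕ) →
             Σₗ n (λ l → Σᵥ (F l)) ≡ Σᵥ (λ v → Σₗ n (λ l → F l v))
Σₗ-Σᵥ-comm n {zero}  F = Σₗ-const n 0
Σₗ-Σᵥ-comm n {suc m} F = trans (Σₗ-+ n (λ l → F l zero) (λ l → Σᵥ (F l ∘ suc)))
  (cong (Σₗ n (λ l → F l zero) +_) (Σₗ-Σᵥ-comm n (λ l → F l ∘ suc)))

Σᵥ-bound : ∀ {m} k c (G : Fin m → ℕ) → (∀ v → k * G v ≤ c) → k * Σᵥ G ≤ m * c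
Σᵥ-bound {zero}  k c G bound = ≤-reflexive (*-zeroʳ k)
Σᵥ-bound {suc m} k c G bound = begin
  k * (G zero + Σᵥ (G ∘ suc))     ≡⟨ *-distribˡ-+ k (G zero) _ ⟩
  k * G zero + k * Σᵥ (G ∘ suc)   ≤⟨ +-mono-≤ (bound zero) (Σᵥ-bound k c (G ∘ suc) (bound ∘ suc)) ⟩
  c + m * c                       ∎
  where open ≤-Reasoning

nonempty : ∀ {m} (p : Subset m) → 1 ≤ ∣ p ∣ → Nonempty p
nonempty {m} p 1≤∣p∣ with nonempty? p
... | yes p≠∅ = p≠∅
... | no  p=∅ = contradiction (trans (cong ∣_∣ (Empty-unique p=∅)) (∣⊥∣≡0 m)) (>⇒≢ 1≤∣p∣)

anyFin-true : ∀ {m} (f : Fin m → Bool) u → f u ≡ true → anyFin f ≡ true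
anyFin-true f zero    fu≡true = cong (_∨ anyFin (f ∘ suc)) fu≡true
anyFin-true f (suc u) fu≡true =
  trans (cong (f zero ∨_) (anyFin-true (f ∘ suc) u fu≡true)) (∨-zeroʳ (f zero))

inL : ∀ {n} → (Fin n → Subset n) → Vec Bool n → Fin n → Bool
inL S l v = lookup l v ∨ not (anyFin λ w → lookup (S v ∪ ⁅ v ⁆) w ∧ lookup l w)

sumL-by-vertex : ∀ {n} (S : Fin n → Subset n) →
                 sumL S ≡ Σᵥ (λ v → Σₗ n (λ l → indicator (inL S l v)))
sumL-by-vertex {n} S = begin
  sumL S                                         ≡⟨ sumL≡Σₗ S ⟩
  Σₗ n (λ l → ∣ tabulate (inL S l) ∣)            ≡⟨ Σₗ-cong n (λ l → ∣tabulate∣ (inL S l)) ⟩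
  Σₗ n (λ l → Σᵥ (indicator ∘ inL S l))          ≡⟨ Σₗ-Σᵥ-comm n (λ l → indicator ∘ inL S l) ⟩
  Σᵥ (λ v → Σₗ n (λ l → indicator (inL S l v))) ∎
  where open ≡-Reasoning

inL-bound : ∀ {n} (S : Fin n → Subset n) {v u} → u ∈ S v → ∀ l →
            indicator (inL S l v) ≤ indicator (lookup l v ∨ not (lookup l u))
inL-bound S {v} {u} u∈Sv l with lookup l v | lookup l u in lu≡
... | true  | _     = ≤-refl
... | false | false = indicator≤1 _
... | false | true  = ≤-reflexive (cong (indicator ∘ not) u-blocks-v)
  where
    u∈Sv∪v : lookup (S v ∪ ⁅ v ⁆) u ≡ true
    u∈Sv∪v = []=⇒lookup (x∈p∪q⁺ (inj₁ u∈Sv))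
    u-blocks-v : anyFin (λ w → lookup (S v ∪ ⁅ v ⁆) w ∧ lookup l w) ≡ true
    u-blocks-v = anyFin-true _ u (cong₂ _∧_ u∈Sv∪v lu≡)

vertex-bound : ∀ {n} (S : Fin n → Subset n) → (∀ v → v ∉ S v) → (∀ v → 1 ≤ ∣ S v ∣) →
               ∀ v → 4 * Σₗ n (λ l → indicator (inL S l v)) ≤ 3 * 2 ^ n
vertex-bound {n} S v∉Sv 1≤∣Sv∣ v with nonempty (S v) (1≤∣Sv∣ v)
... | u , u∈Sv = begin
  4 * Σₗ n (λ l → indicator (inL S l v))
    ≤⟨ *-monoʳ-≤ 4 (Σₗ-mono n (inL-bound S u∈Sv)) ⟩
  4 * Σₗ n (λ l → indicator (lookup l v ∨ not (lookup l u)))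
    ≡⟨ Σₗ-two n (λ a b → indicator (a ∨ not b)) v u v≢u ⟩
  3 * 2 ^ n ∎
  where
    open ≤-Reasoning
    v≢u : v ≢ u
    v≢u refl = v∉Sv v u∈Sv

mainTheorem10 : (n : ℕ) (S : Fin n → Subset n) →
    (∀ v → v ∉ S v) → (∀ v → 1 ≤ ∣ S v ∣) →
    4 * sumL S ≤ 3 * n * 2 ^ n
mainTheorem10 n S v∉Sv 1≤∣Sv∣ = begin
  4 * sumL S
    ≡⟨ cong (4 *_) (sumL-by-vertex S) ⟩
  4 * Σᵥ (λ v → Σₗ n (λ l → indicator (inL S l v)))
    ≤⟨ Σᵥ-bound 4 (3 * 2 ^ n) _ (vertex-bound S v∉Sv 1≤∣Sv∣) ⟩
  n * (3 * 2 ^ n)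
    ≡⟨ sym (*-assoc n 3 (2 ^ n)) ⟩
  n * 3 * 2 ^ n
    ≡⟨ cong (_* 2 ^ n) (*-comm n 3) ⟩
  3 * n * 2 ^ n ∎
  where open ≤-Reasoning
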